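{- Let $f,g,h,n$ be positive integers with $f\geq g$ and $n\geq f+h$. Let $$\mathcal{F}=\Big\{F\in\tbinom{[n]}{f}:\ \exists H\in\tbinom{[n]}{h}\text{ such that }(F,H)\text{ is maximal}\Big\},\quad \mathcal{G}=\Big\{G\in\tbinom{[n]}{g}:\ \exists H\in\tbinom{[n]}{h}\text{ such that }(G,H)\text{ is maximal}\Big\}.$$ Let $\mathcal{H}_{\mathcal{F}},\mathcal{H}_{\mathcal{G}}\subseteq\binom{[n]}{h}$ be families such that $\mathcal{F}$ and $\mathcal{H}_{\mathcal{F}}$ are maximal pair families and $\mathcal{G}$ and $\mathcal{H}_{\mathcal{G}}$ are maximal pair families. Then: (i) $\mathcal{F}$ is the $f$-parity of $\mathcal{G}$, i.e. for every $G\in\mathcal{G}$ the $f$-parity of $G$ exists and belongs to $\mathcal{F}$, and every $F\in\mathcal{F}$ either has no $g$-parity or its $g$-parity belongs to $\mathcal{G}$; (ii) $\mathcal{H}_{\mathcal{G}}\subseteq\mathcal{H}_{\mathcal{F}}$; (iii) for every $G\in\mathcal{G}$, if $F\in\mathcal{F}$ is the $f$-parity of $G$ and $H$ is an $h$-set such that $(F,H)$ is maximal, then $(G,H)$ is maximal.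
   Context: Lexicographic order: for finite sets $A,B$ of positive integers, $A\prec B$ if either $A\supseteq B$ or $\min(A\setminus B)<\min(B\setminus A)$. For a $k$-subset $R$ of $[n]$, $\mathcal{L}(R,k)=\{F\in\binom{[n]}{k}:F\prec R\}$. A cross-intersecting pair $(\mathcal{A},\mathcal{B})$ of uniform families on $[n]$ is maximal if it cannot be enlarged (keeping uniformities) while remaining cross-intersecting; for sets $A,B$, $(A,B)$ is maximal if $\mathcal{L}(A,|A|)$ and $\mathcal{L}(B,|B|)$ are cross-intersecting and form a maximal pair. Two families $\mathcal{A}_1,\mathcal{A}_2$ are maximal pair families if $|\mathcal{A}_1|=|\mathcal{A}_2|$ and for every $A_1\in\mathcal{A}_1$ there is a unique $A_2\in\mathcal{A}_2$ such that $(A_1,A_2)$ is maximal. For $F\subseteq[n]$, $\ell(F)=\max\{x:[n-x+1,n]\subseteq F\}$ if $n\in F$ and $\ell(F)=0$ otherwise; $F^{\mathrm t}=[n-\ell(F)+1,n]$ (empty if $\ell(F)=0$). For $h_1\le h_2$, an $h_1$-set $H_1$ and an $h_2$-set $H_2$ in $[n]$: $H_1$ is the $h_1$-parity of $H_2$ (equivalently $H_2$ is the $h_2$-parity of $H_1$) if $H_1\setminus H_1^{\mathrm t}=H_2\setminus H_2^{\mathrm t}$ and $\ell(H_2)-\ell(H_1)=h_2-h_1$. -}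

module Defs where

open import Data.Bool using (Bool; true; false; T; if_then_else_)
open import Data.Nat using (ℕ; zero; suc; _+_; _≤_; _≤?_)
open import Data.Fin using (Fin; toℕ; _<_)
open import Data.Fin.Subset using (Subset; _∈_; _∉_; _⊆_; _∩_; _─_; ∣_∣; Nonempty; outside; inside)
open import Data.Vec using (Vec; []; _∷_; reverse; tabulate)
open import Data.List using (List; []; _∷_; map; _++_; length; filterᵇ)
open import Data.Product using (Σ; ∃; ∃-syntax; ∃!; _×_; _,_)
open import Data.Sum using (_⊎_)
open import Relation.Nullary using (¬_; does)
open import Relation.Binary.PropositionalEquality using (_≡_)

-- A subset of [n] = {1,…,n} is a Subset n; index i : Fin n stands for the integer i+1.

_≺_ : ∀ {n} → Subset n → Subset n → Set
_≺_ {n} A B = (B ⊆ A) ⊎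
  (Σ (Fin n) λ x → x ∈ A × x ∉ B × (∀ y → y ∈ B → y ∉ A → x < y))

Family : ℕ → Set
Family n = Subset n → Bool

L : ∀ {n} → Subset n → ℕ → Subset n → Set
L R k F = ∣ F ∣ ≡ k × F ≺ R

CrossIntersecting : ∀ {n} → (Subset n → Set) → (Subset n → Set) → Set
CrossIntersecting 𝒜 ℬ = ∀ A B → 𝒜 A → ℬ B → Nonempty (A ∩ B)

_∪｛_｝ : ∀ {n} → (Subset n → Set) → Subset n → (Subset n → Set)
(𝒜 ∪｛ A ｝) X = 𝒜 X ⊎ X ≡ A

MaximalPair : ∀ {n} → ℕ → ℕ → (Subset n → Set) → (Subset n → Set) → Set
MaximalPair {n} a b 𝒜 ℬ =
  CrossIntersecting 𝒜 ℬ
  × (∀ (A : Subset n) → ∣ A ∣ ≡ a → ¬ 𝒜 A → ¬ CrossIntersecting (𝒜 ∪｛ A ｝) ℬ)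
  × (∀ (B : Subset n) → ∣ B ∣ ≡ b → ¬ ℬ B → ¬ CrossIntersecting 𝒜 (ℬ ∪｛ B ｝))

MaximalSets : ∀ {n} → Subset n → Subset n → Set
MaximalSets A B = MaximalPair ∣ A ∣ ∣ B ∣ (L A ∣ A ∣) (L B ∣ B ∣)

allSubsets : ∀ n → List (Subset n)
allSubsets zero = [] ∷ []
allSubsets (suc n) = map (outside ∷_) (allSubsets n) ++ map (inside ∷_) (allSubsets n)

#_ : ∀ {n} → Family n → ℕ
#_ {n} 𝒜 = length (filterᵇ 𝒜 (allSubsets n))

MaxPairFamilies : ∀ {n} → Family n → Family n → Set
MaxPairFamilies {n} 𝒜₁ 𝒜₂ =
  # 𝒜₁ ≡ # 𝒜₂
  × (∀ A₁ → T (𝒜₁ A₁) → ∃! _≡_ (λ (A₂ : Subset n) → T (𝒜₂ A₂) × MaximalSets A₁ A₂))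

leadingRun : ∀ {m} → Vec Bool m → ℕ
leadingRun [] = 0
leadingRun (true ∷ v) = suc (leadingRun v)
leadingRun (false ∷ v) = 0

-- ℓ(F) = max{x : [n-x+1, n] ⊆ F} (= 0 if n ∉ F): length of the final run of F.
ℓ : ∀ {n} → Subset n → ℕ
ℓ F = leadingRun (reverse F)

-- Fᵗ = [n-ℓ(F)+1, n]; element i+1 (i : Fin n) lies in it iff n ≤ i + ℓ(F).
_ᵗ : ∀ {n} → Subset n → Subset n
_ᵗ {n} F = tabulate (λ i → if does (n ≤? toℕ i + ℓ F) then inside else outside)

-- Parity h₁ h₂ H₁ H₂ : (h₁ ≤ h₂) H₁ is an h₁-set, H₂ an h₂-set, and H₁ is the
-- h₁-parity of H₂ (equivalently H₂ is the h₂-parity of H₁).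
-- ℓ(H₂) - ℓ(H₁) = h₂ - h₁ is written additively: ℓ(H₂) + h₁ = ℓ(H₁) + h₂.
Parity : ∀ {n} → ℕ → ℕ → Subset n → Subset n → Set
Parity h₁ h₂ H₁ H₂ =
  h₁ ≤ h₂ × ∣ H₁ ∣ ≡ h₁ × ∣ H₂ ∣ ≡ h₂
  × (H₁ ─ (H₁ ᵗ)) ≡ (H₂ ─ (H₂ ᵗ))
  × ℓ H₂ + h₁ ≡ ℓ H₁ + h₂

{-# OPTIONS --safe #-}
module Submission where

-- For |F| + |H| ≤ n the pair (F, H) is maximal exactly when F and H are interlocked:
-- up to a first common element p every element of [n] lies in exactly one of them,
-- and beyond p both are final segments of [n].  Read from 1 upward, this shape depends
-- on F only through F ∖ Fᵗ and through F being final beyond p, so it survives shortening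
-- the final run of F and, when there is room, lengthening it; this gives (iii) and (i).
-- Maximal partners of a given size are unique (two of them precede each other in ≺),
-- so G ↦ partner is an injection 𝓖 → 𝓗𝓖, hence onto as |𝓖| = |𝓗𝓖|.  For H ∈ 𝓗𝓖
-- with partner G, the partner in 𝓗𝓕 of the f-parity of G is by (iii) a partner of G,
-- hence equal to H.

open import Defs
open import Data.Bool using (T; T?; if_then_else_)
open import Data.Bool.Properties using () renaming (_≟_ to _≟ᵇ_)
open import Data.Empty using (⊥)
open import Data.Fin as Fin using (zero; suc; toℕ)
open import Data.Fin.Properties using (¬Fin0)
open import Data.Fin.Subset
  using (Subset; _∈_; _∉_; _∩_; _─_; ∣_∣; Nonempty; Empty; inside; outside; ⊤)
  renaming (⊥ to ∅)
open import Data.Fin.Subset.Properties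
  using (drop-there; drop-not-there; ∩-comm; x∈p∩q⁻; ∣p∣≤n; ∣⊤∣≡n; ∣p∣≡n⇒p≡⊤; p─⊤≡⊥)
open import Data.List as List using (List; []; _∷_; length; filter; filterᵇ)
open import Data.List.Properties using (filter-notAll)
open import Data.List.Membership.Propositional using () renaming (_∈_ to _∈ˡ_)
open import Data.List.Membership.Propositional.Properties
  using (∈-filter⁺; ∈-filter⁻; ∈-map⁺; ∈-map⁻; ∈-++⁺ˡ; ∈-++⁺ʳ)
import Data.List.Relation.Unary.All as All
open import Data.List.Relation.Unary.Any as Any using (here; there)
open import Data.List.Relation.Unary.Unique.Propositional using (Unique; []; _∷_)
import Data.List.Relation.Unary.Unique.Propositional.Properties as Unique
open import Data.Nat using (ℕ; zero; suc; _+_; _≤_; _<_; _∸_; z≤n; s≤s; _≤?_)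
open import Data.Nat.Properties as ℕ using (≤-pred; suc-injective; +-suc; +-comm; m≤m+n; ≤-trans; <-irrefl)
open import Data.Product using (Σ; ∃-syntax; _×_; _,_; proj₁; proj₂; map₁; map₂)
open import Data.Sum using (inj₁; inj₂)
import Data.Unit as Unit
open import Data.Vec as Vec using ([]; _∷_; here; there; reverse; _∷ʳ_; tabulate)
open import Data.Vec.Properties
  using (≡-dec; ∷-injective; ∷-injectiveʳ; map-const; map-reverse; reverse-∷; reverse-injective;
         tabulate-cong)
open import Function using (_∘_; const)
open import Function.Bundles using (_⇔_; mk⇔; Equivalence)
open import Relation.Binary.Definitions using (DecidableEquality)
open import Relation.Binary.PropositionalEquality
open import Relation.Nullary using (¬_; ¬?; Dec; yes; no; does; contradiction)
open import Relation.Nullary.Decidable using (dec-true; dec-false; does-⇔)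

private
  variable
    n : ℕ
    𝒜 ℬ : Subset n → Set
    𝒜′ ℬ′ : Subset (suc n) → Set

-- Lexicographic order

≺-refl : (A : Subset n) → A ≺ A
≺-refl A = inj₁ (λ x∈A → x∈A)

≺-reflexive : {A B : Subset n} → A ≡ B → A ≺ B
≺-reflexive {A = A} refl = ≺-refl A

inside∷≺outside∷ : (A B : Subset n) → (inside ∷ A) ≺ (outside ∷ B)
inside∷≺outside∷ A B = inj₂ (zero , here , (λ ()) , λ { zero () ; (suc y) _ _ → s≤s z≤n })

outside∷⊀inside∷ : (A B : Subset n) → ¬ (outside ∷ A) ≺ (inside ∷ B)
outside∷⊀inside∷ A B (inj₁ B⊆A) with B⊆A here
... | ()
outside∷⊀inside∷ A B (inj₂ (zero , () , _))
outside∷⊀inside∷ A B (inj₂ (suc x , _ , _ , x<)) with x< zero here (λ ())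
... | ()

∷-≺-∷⁺ : ∀ x {A B : Subset n} → A ≺ B → (x ∷ A) ≺ (x ∷ B)
∷-≺-∷⁺ x (inj₁ B⊆A) = inj₁ λ { here → here ; (there y∈B) → there (B⊆A y∈B) }
∷-≺-∷⁺ x {A} {B} (inj₂ (z , z∈A , z∉B , z<)) =
  inj₂ (suc z , there z∈A , z∉B ∘ drop-there , suc-z<)
  where
  suc-z< : ∀ y → y ∈ (x ∷ B) → y ∉ (x ∷ A) → suc z Fin.< y
  suc-z< zero here zero∉ = contradiction here zero∉
  suc-z< (suc y) y∈ y∉ = s≤s (z< y (drop-there y∈) (y∉ ∘ there))

∷-≺-∷⁻ : ∀ x {A B : Subset n} → (x ∷ A) ≺ (x ∷ B) → A ≺ B
∷-≺-∷⁻ x (inj₁ B⊆A) = inj₁ (drop-there ∘ B⊆A ∘ there)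
∷-≺-∷⁻ x (inj₂ (zero , here , zero∉ , _)) = contradiction here zero∉
∷-≺-∷⁻ x (inj₂ (suc z , z∈A , z∉B , z<)) =
  inj₂ (z , drop-there z∈A , drop-not-there z∉B ,
        λ y y∈B y∉A → ≤-pred (z< (suc y) (there y∈B) (y∉A ∘ drop-there)))

_≺?_ : (A B : Subset n) → Dec (A ≺ B)
[] ≺? [] = yes (≺-refl [])
(inside ∷ A) ≺? (outside ∷ B) = yes (inside∷≺outside∷ A B)
(outside ∷ A) ≺? (inside ∷ B) = no (outside∷⊀inside∷ A B)
(inside ∷ A) ≺? (inside ∷ B) with A ≺? B
... | yes A≺B = yes (∷-≺-∷⁺ inside A≺B)
... | no A⊀B = no (A⊀B ∘ ∷-≺-∷⁻ inside)
(outside ∷ A) ≺? (outside ∷ B) with A ≺? B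
... | yes A≺B = yes (∷-≺-∷⁺ outside A≺B)
... | no A⊀B = no (A⊀B ∘ ∷-≺-∷⁻ outside)

≺-antisym : {A B : Subset n} → A ≺ B → B ≺ A → A ≡ B
≺-antisym {A = []} {[]} _ _ = refl
≺-antisym {A = inside ∷ A} {inside ∷ B} A≺B B≺A =
  cong (inside ∷_) (≺-antisym (∷-≺-∷⁻ inside A≺B) (∷-≺-∷⁻ inside B≺A))
≺-antisym {A = outside ∷ A} {outside ∷ B} A≺B B≺A =
  cong (outside ∷_) (≺-antisym (∷-≺-∷⁻ outside A≺B) (∷-≺-∷⁻ outside B≺A))
≺-antisym {A = inside ∷ A} {outside ∷ B} _ B≺A = contradiction B≺A (outside∷⊀inside∷ B A)
≺-antisym {A = outside ∷ A} {inside ∷ B} A≺B _ = contradiction A≺B (outside∷⊀inside∷ A B)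

≤-pred-+-suc : ∀ {a b} → a + suc b ≤ suc n → a + b ≤ n
≤-pred-+-suc {n} {a} {b} le = ≤-pred (subst (_≤ suc n) (+-suc a b) le)

Nonempty-∩-comm : (A B : Subset n) → Nonempty (A ∩ B) → Nonempty (B ∩ A)
Nonempty-∩-comm A B = subst Nonempty (∩-comm A B)

Nonempty-∷-∩-∷⁺ : ∀ x y {A B : Subset n} → Nonempty (A ∩ B) → Nonempty ((x ∷ A) ∩ (y ∷ B))
Nonempty-∷-∩-∷⁺ x y (i , i∈) = suc i , there i∈

Nonempty-outside∷-∩⁻ : ∀ y (A B : Subset n) → Nonempty ((outside ∷ A) ∩ (y ∷ B)) → Nonempty (A ∩ B)
Nonempty-outside∷-∩⁻ y A B (suc i , there i∈) = i , i∈

Nonempty-∩-outside∷⁻ : ∀ x (A B : Subset n) → Nonempty ((x ∷ A) ∩ (outside ∷ B)) → Nonempty (A ∩ B)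
Nonempty-∩-outside∷⁻ x A B =
  Nonempty-∩-comm B A ∘ Nonempty-outside∷-∩⁻ x B A ∘ Nonempty-∩-comm (x ∷ A) (outside ∷ B)

Nonempty-∩⇒Nonempty : (A B : Subset n) → Nonempty (A ∩ B) → Nonempty B
Nonempty-∩⇒Nonempty A B (i , i∈A∩B) = i , proj₂ (x∈p∩q⁻ A B i∈A∩B)

Nonempty⇒∣∣≡suc : (A : Subset n) → Nonempty A → Σ ℕ λ k → ∣ A ∣ ≡ suc k
Nonempty⇒∣∣≡suc (inside ∷ A) _ = ∣ A ∣ , refl
Nonempty⇒∣∣≡suc (outside ∷ A) (suc i , there i∈A) = Nonempty⇒∣∣≡suc A (i , i∈A)

∣∣≢suc : (A : Subset n) → ∣ A ∣ ≢ suc n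
∣∣≢suc {n} A eq = <-irrefl refl (subst (_≤ n) eq (∣p∣≤n A))

Nonempty-∩⇒≢⊤ : (A B : Subset n) → Nonempty (A ∩ B) → ∣ A ∣ + ∣ B ∣ ≤ n → A ≢ ⊤
Nonempty-∩⇒≢⊤ {n} A B ne size refl
  with k , ∣B∣≡1+k ← Nonempty⇒∣∣≡suc B (Nonempty-∩⇒Nonempty A B ne) =
  <-irrefl refl (begin-strict
    n             <⟨ ℕ.m<m+n n (s≤s z≤n) ⟩
    n + suc k     ≡⟨ cong₂ _+_ (sym (∣⊤∣≡n n)) (sym ∣B∣≡1+k) ⟩
    ∣ A ∣ + ∣ B ∣ ≤⟨ size ⟩
    n             ∎)
  where open ℕ.≤-Reasoning

disjoint-of-size : ∀ k (S : Subset n) → k + ∣ S ∣ ≤ n → Σ (Subset n) λ X → ∣ X ∣ ≡ k × Empty (X ∩ S)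
disjoint-of-size zero [] _ = [] , refl , λ ()
disjoint-of-size k (inside ∷ S) size
  with X , ∣X∣ , X∩S=∅ ← disjoint-of-size k S (≤-pred-+-suc size) =
  outside ∷ X , ∣X∣ , X∩S=∅ ∘ Nonempty-outside∷-∩⁻ inside X S
disjoint-of-size zero (outside ∷ S) _
  with X , ∣X∣ , X∩S=∅ ← disjoint-of-size zero S (∣p∣≤n S) =
  outside ∷ X , ∣X∣ , X∩S=∅ ∘ Nonempty-outside∷-∩⁻ outside X S
disjoint-of-size (suc k) (outside ∷ S) size
  with X , ∣X∣ , X∩S=∅ ← disjoint-of-size k S (≤-pred size) =
  inside ∷ X , cong suc ∣X∣ , X∩S=∅ ∘ Nonempty-∩-outside∷⁻ inside X S

-- Final segments

IsFinal : Subset n → Set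
IsFinal [] = Unit.⊤
IsFinal (inside ∷ F) = F ≡ ⊤
IsFinal (outside ∷ F) = IsFinal F

⊤-final : ∀ n → IsFinal (⊤ {n})
⊤-final zero = Unit.tt
⊤-final (suc n) = refl

final-of-size : ∀ {n k} → k ≤ n → Σ (Subset n) λ F → IsFinal F × ∣ F ∣ ≡ k
final-of-size {zero} z≤n = [] , Unit.tt , refl
final-of-size {suc n} {k} k≤1+n with k ≤? n
... | yes k≤n with F , F-final , ∣F∣ ← final-of-size k≤n = outside ∷ F , F-final , ∣F∣
... | no k≰n = ⊤ , ⊤-final (suc n) , trans (∣⊤∣≡n (suc n)) (ℕ.≤-antisym (ℕ.≰⇒> k≰n) k≤1+n)

final⇒≺-greatest : (F : Subset n) → IsFinal F → ∀ X → ∣ X ∣ ≡ ∣ F ∣ → X ≺ F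
final⇒≺-greatest [] _ [] _ = ≺-refl []
final⇒≺-greatest (outside ∷ F) F-final (outside ∷ X) ∣X∣ = ∷-≺-∷⁺ outside (final⇒≺-greatest F F-final X ∣X∣)
final⇒≺-greatest (outside ∷ F) _ (inside ∷ X) _ = inside∷≺outside∷ X F
final⇒≺-greatest (inside ∷ F) refl (inside ∷ X) ∣X∣ =
  ≺-reflexive (cong (inside ∷_) (∣p∣≡n⇒p≡⊤ (trans (suc-injective ∣X∣) (∣⊤∣≡n _))))
final⇒≺-greatest (inside ∷ F) refl (outside ∷ X) ∣X∣ =
  contradiction (trans ∣X∣ (cong suc (∣⊤∣≡n _))) (∣∣≢suc X)

≺-greatest⇒final : (F : Subset n) → (∀ X → ∣ X ∣ ≡ ∣ F ∣ → X ≺ F) → IsFinal F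
≺-greatest⇒final [] _ = Unit.tt
≺-greatest⇒final (outside ∷ F) greatest =
  ≺-greatest⇒final F (λ X ∣X∣ → ∷-≺-∷⁻ outside (greatest (outside ∷ X) ∣X∣))
≺-greatest⇒final {suc n} (inside ∷ F) greatest with suc ∣ F ∣ ≤? n
... | yes room with X , _ , ∣X∣ ← final-of-size room =
  contradiction (greatest (outside ∷ X) ∣X∣) (outside∷⊀inside∷ X F)
... | no no-room = ∣p∣≡n⇒p≡⊤ {p = F} (ℕ.≤-antisym (∣p∣≤n F) (ℕ.≮⇒≥ no-room))

-- Maximal pairs of lexicographic initial segments

CrossIntersecting-sym : CrossIntersecting 𝒜 ℬ → CrossIntersecting ℬ 𝒜
CrossIntersecting-sym ci B A B∈ℬ A∈𝒜 = Nonempty-∩-comm A B (ci A B A∈𝒜 B∈ℬ)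

maximal-sym : {F H : Subset n} → MaximalSets F H → MaximalSets H F
maximal-sym (ci , F-max , H-max) =
  CrossIntersecting-sym ci ,
  (λ X ∣X∣ X∉ ci⁺ → H-max X ∣X∣ X∉ (CrossIntersecting-sym ci⁺)) ,
  (λ X ∣X∣ X∉ ci⁺ → F-max X ∣X∣ X∉ (CrossIntersecting-sym ci⁺))

maximal⇒Nonempty : {F H : Subset n} → MaximalSets F H → Nonempty (F ∩ H)
maximal⇒Nonempty {F = F} {H} (ci , _ , _) = ci F H (refl , ≺-refl F) (refl , ≺-refl H)

maximal-partner-≺ : {G H₁ H₂ : Subset n} → MaximalSets G H₁ → MaximalSets G H₂ →
  ∣ H₂ ∣ ≡ ∣ H₁ ∣ → H₂ ≺ H₁
maximal-partner-≺ {G = G} {H₁} {H₂} (ci₁ , _ , H₁-max) (ci₂ , _ , _) ∣H₂∣ with H₂ ≺? H₁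
... | yes H₂≺H₁ = H₂≺H₁
... | no H₂⊀H₁ = contradiction ci⁺ (H₁-max H₂ ∣H₂∣ (H₂⊀H₁ ∘ proj₂))
  where
  ci⁺ : CrossIntersecting (L G ∣ G ∣) (L H₁ ∣ H₁ ∣ ∪｛ H₂ ｝)
  ci⁺ Z W Z∈ (inj₁ W∈) = ci₁ Z W Z∈ W∈
  ci⁺ Z W Z∈ (inj₂ refl) = ci₂ Z H₂ Z∈ (refl , ≺-refl H₂)

maximal-partner-unique : {G H₁ H₂ : Subset n} → MaximalSets G H₁ → MaximalSets G H₂ →
  ∣ H₁ ∣ ≡ ∣ H₂ ∣ → H₁ ≡ H₂
maximal-partner-unique M₁ M₂ eq = ≺-antisym (maximal-partner-≺ M₂ M₁ eq) (maximal-partner-≺ M₁ M₂ (sym eq))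

∪｛｝-∷⁺ : ∀ x (𝒜′ : Subset (suc n) → Set) {A : Subset n} → (∀ {Z} → 𝒜 Z → 𝒜′ (x ∷ Z)) →
  ∀ {Z} → (𝒜 ∪｛ A ｝) Z → (𝒜′ ∪｛ x ∷ A ｝) (x ∷ Z)
∪｛｝-∷⁺ x _ f (inj₁ Z∈) = inj₁ (f Z∈)
∪｛｝-∷⁺ x _ f (inj₂ refl) = inj₂ refl

∪｛｝-∷⁻ : ∀ x (𝒜′ : Subset (suc n) → Set) {A : Subset n} → (∀ {Z} → 𝒜′ (x ∷ Z) → 𝒜 Z) →
  ∀ {Z} → (𝒜′ ∪｛ x ∷ A ｝) (x ∷ Z) → (𝒜 ∪｛ A ｝) Z
∪｛｝-∷⁻ x _ f (inj₁ Z∈) = inj₁ (f Z∈)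
∪｛｝-∷⁻ x _ f (inj₂ refl) = inj₂ refl

CrossIntersecting-inside∷ : (∀ {Z} → ¬ 𝒜′ (outside ∷ Z)) → (∀ {W} → ¬ ℬ′ (outside ∷ W)) →
  CrossIntersecting 𝒜′ ℬ′
CrossIntersecting-inside∷ no-outside _ (outside ∷ Z) W Z∈ _ = contradiction Z∈ no-outside
CrossIntersecting-inside∷ _ no-outside (inside ∷ Z) (outside ∷ W) _ W∈ = contradiction W∈ no-outside
CrossIntersecting-inside∷ _ _ (inside ∷ Z) (inside ∷ W) _ _ = zero , here

CrossIntersecting-inside∷-outside∷⁺ :
  (∀ {Z} → ¬ 𝒜′ (outside ∷ Z)) → (∀ {Z} → 𝒜′ (inside ∷ Z) → 𝒜 Z) → (∀ {W} → ℬ′ (outside ∷ W) → ℬ W) →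
  CrossIntersecting 𝒜 ℬ → CrossIntersecting 𝒜′ ℬ′
CrossIntersecting-inside∷-outside∷⁺ no-outside _ _ _ (outside ∷ Z) W Z∈ _ = contradiction Z∈ no-outside
CrossIntersecting-inside∷-outside∷⁺ _ _ _ _ (inside ∷ Z) (inside ∷ W) _ _ = zero , here
CrossIntersecting-inside∷-outside∷⁺ _ f g ci (inside ∷ Z) (outside ∷ W) Z∈ W∈ =
  Nonempty-∷-∩-∷⁺ inside outside (ci Z W (f Z∈) (g W∈))

CrossIntersecting-inside∷-outside∷⁻ :
  (∀ {Z} → 𝒜 Z → 𝒜′ (inside ∷ Z)) → (∀ {W} → ℬ W → ℬ′ (outside ∷ W)) →
  CrossIntersecting 𝒜′ ℬ′ → CrossIntersecting 𝒜 ℬ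
CrossIntersecting-inside∷-outside∷⁻ f g ci Z W Z∈ W∈ = Nonempty-∩-outside∷⁻ inside Z W (ci _ _ (f Z∈) (g W∈))

¬CrossIntersecting-outside∷ : ∀ k (X : Subset n) → k + ∣ X ∣ ≤ n → 𝒜′ (outside ∷ X) →
  (∀ Y → ∣ Y ∣ ≡ k → ℬ′ (inside ∷ Y)) → ¬ CrossIntersecting 𝒜′ ℬ′
¬CrossIntersecting-outside∷ k X room X∈ all-k ci with Y , ∣Y∣ , Y∩X=∅ ← disjoint-of-size k X room =
  Y∩X=∅ (Nonempty-∩-comm X Y (Nonempty-outside∷-∩⁻ inside X Y (ci _ _ X∈ (all-k Y ∣Y∣))))

module _ (F : Subset n) {k : ℕ} where

  L-inside∷⁺ : ∀ {X} → L F k X → L (inside ∷ F) (suc k) (inside ∷ X)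
  L-inside∷⁺ (∣X∣ , X≺F) = cong suc ∣X∣ , ∷-≺-∷⁺ inside X≺F

  L-inside∷⁻ : ∀ {X} → L (inside ∷ F) (suc k) (inside ∷ X) → L F k X
  L-inside∷⁻ (∣X∣ , X≺F) = suc-injective ∣X∣ , ∷-≺-∷⁻ inside X≺F

  L-outside∷⁺ : ∀ {X} → L F k X → L (outside ∷ F) k (outside ∷ X)
  L-outside∷⁺ (∣X∣ , X≺F) = ∣X∣ , ∷-≺-∷⁺ outside X≺F

  L-outside∷⁻ : ∀ {X} → L (outside ∷ F) k (outside ∷ X) → L F k X
  L-outside∷⁻ (∣X∣ , X≺F) = ∣X∣ , ∷-≺-∷⁻ outside X≺F

¬L-inside∷-outside∷ : (F : Subset n) → ∀ {k X} → ¬ L (inside ∷ F) k (outside ∷ X)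
¬L-inside∷-outside∷ F {X = X} (_ , X≺F) = outside∷⊀inside∷ X F X≺F

inside∷-outside∷-maximal⁺ : {F H : Subset n} → ∣ F ∣ + ∣ H ∣ ≤ n →
  MaximalSets F H → MaximalSets (inside ∷ F) (outside ∷ H)
inside∷-outside∷-maximal⁺ {n} {F} {H} size M@(ci , F-max , H-max) = ci′ , F′-max , H′-max
  where
  ci′ : CrossIntersecting (L (inside ∷ F) (suc ∣ F ∣)) (L (outside ∷ H) ∣ H ∣)
  ci′ = CrossIntersecting-inside∷-outside∷⁺ (¬L-inside∷-outside∷ F) (L-inside∷⁻ F) (L-outside∷⁻ H) ci

  F′-max : ∀ X → ∣ X ∣ ≡ suc ∣ F ∣ → ¬ L (inside ∷ F) (suc ∣ F ∣) X →
           ¬ CrossIntersecting (L (inside ∷ F) (suc ∣ F ∣) ∪｛ X ｝) (L (outside ∷ H) ∣ H ∣)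
  F′-max (inside ∷ X) ∣X∣ X∉ ci⁺ =
    F-max X (suc-injective ∣X∣) (X∉ ∘ L-inside∷⁺ F)
      (CrossIntersecting-inside∷-outside∷⁻ (∪｛｝-∷⁺ inside (L (inside ∷ F) (suc ∣ F ∣)) (L-inside∷⁺ F))
        (L-outside∷⁺ H) ci⁺)
  F′-max (outside ∷ X) ∣X∣ _
    with k , ∣H∣ ← Nonempty⇒∣∣≡suc H (Nonempty-∩⇒Nonempty F H (maximal⇒Nonempty M)) =
    ¬CrossIntersecting-outside∷ k X room (inj₂ refl)
      (λ Y ∣Y∣ → trans (cong suc ∣Y∣) (sym ∣H∣) , inside∷≺outside∷ Y H)
    where
    room : k + ∣ X ∣ ≤ n
    room = subst (_≤ n) (begin
      ∣ F ∣ + ∣ H ∣   ≡⟨ cong (∣ F ∣ +_) ∣H∣ ⟩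
      ∣ F ∣ + suc k   ≡⟨ +-comm ∣ F ∣ (suc k) ⟩
      suc k + ∣ F ∣   ≡⟨ +-suc k ∣ F ∣ ⟨
      k + suc ∣ F ∣   ≡⟨ cong (k +_) ∣X∣ ⟨
      k + ∣ X ∣       ∎) size
      where open ≡-Reasoning

  H′-max : ∀ Y → ∣ Y ∣ ≡ ∣ H ∣ → ¬ L (outside ∷ H) ∣ H ∣ Y →
           ¬ CrossIntersecting (L (inside ∷ F) (suc ∣ F ∣)) (L (outside ∷ H) ∣ H ∣ ∪｛ Y ｝)
  H′-max (inside ∷ Y) ∣Y∣ Y∉ _ = Y∉ (∣Y∣ , inside∷≺outside∷ Y H)
  H′-max (outside ∷ Y) ∣Y∣ Y∉ ci⁺ =
    H-max Y ∣Y∣ (Y∉ ∘ L-outside∷⁺ H)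
      (CrossIntersecting-inside∷-outside∷⁻ (L-inside∷⁺ F)
        (∪｛｝-∷⁺ outside (L (outside ∷ H) ∣ H ∣) (L-outside∷⁺ H)) ci⁺)

inside∷-outside∷-maximal⁻ : {F H : Subset n} → MaximalSets (inside ∷ F) (outside ∷ H) → MaximalSets F H
inside∷-outside∷-maximal⁻ {n} {F} {H} (ci′ , F′-max , H′-max) = ci , F-max , H-max
  where
  ci : CrossIntersecting (L F ∣ F ∣) (L H ∣ H ∣)
  ci = CrossIntersecting-inside∷-outside∷⁻ (L-inside∷⁺ F) (L-outside∷⁺ H) ci′

  F-max : ∀ X → ∣ X ∣ ≡ ∣ F ∣ → ¬ L F ∣ F ∣ X → ¬ CrossIntersecting (L F ∣ F ∣ ∪｛ X ｝) (L H ∣ H ∣)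
  F-max X ∣X∣ X∉ ci⁺ =
    F′-max (inside ∷ X) (cong suc ∣X∣) (X∉ ∘ L-inside∷⁻ F)
      (CrossIntersecting-inside∷-outside∷⁺ (λ { (inj₁ Z∈) → ¬L-inside∷-outside∷ F Z∈ ; (inj₂ ()) })
        (∪｛｝-∷⁻ inside (L (inside ∷ F) (suc ∣ F ∣)) (L-inside∷⁻ F)) (L-outside∷⁻ H) ci⁺)

  H-max : ∀ Y → ∣ Y ∣ ≡ ∣ H ∣ → ¬ L H ∣ H ∣ Y → ¬ CrossIntersecting (L F ∣ F ∣) (L H ∣ H ∣ ∪｛ Y ｝)
  H-max Y ∣Y∣ Y∉ ci⁺ =
    H′-max (outside ∷ Y) ∣Y∣ (Y∉ ∘ L-outside∷⁻ H)
      (CrossIntersecting-inside∷-outside∷⁺ (¬L-inside∷-outside∷ F) (L-inside∷⁻ F)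
        (∪｛｝-∷⁻ outside (L (outside ∷ H) ∣ H ∣) (L-outside∷⁻ H)) ci⁺)

inside∷-inside∷-maximal⇒final : {F H : Subset n} → MaximalSets (inside ∷ F) (inside ∷ H) → IsFinal F
inside∷-inside∷-maximal⇒final {F = F} {H} (_ , F′-max , _) = ≺-greatest⇒final F greatest
  where
  greatest : ∀ X → ∣ X ∣ ≡ ∣ F ∣ → X ≺ F
  greatest X ∣X∣ with X ≺? F
  ... | yes X≺F = X≺F
  ... | no X⊀F = contradiction
    (CrossIntersecting-inside∷ (λ { (inj₁ Z∈) → ¬L-inside∷-outside∷ F Z∈ ; (inj₂ ()) })
                               (¬L-inside∷-outside∷ H))
    (F′-max (inside ∷ X) (cong suc ∣X∣) (X⊀F ∘ ∷-≺-∷⁻ inside ∘ proj₂))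

final-inside∷-maximal-side : {F H : Subset n} → IsFinal F → IsFinal H → ∣ H ∣ + suc ∣ F ∣ ≤ n →
  ∀ X → ∣ X ∣ ≡ suc ∣ F ∣ → ¬ L (inside ∷ F) (suc ∣ F ∣) X →
  ¬ CrossIntersecting (L (inside ∷ F) (suc ∣ F ∣) ∪｛ X ｝) (L (inside ∷ H) (suc ∣ H ∣))
final-inside∷-maximal-side {F = F} F-final _ _ (inside ∷ X) ∣X∣ X∉ _ =
  X∉ (∣X∣ , ∷-≺-∷⁺ inside (final⇒≺-greatest F F-final X (suc-injective ∣X∣)))
final-inside∷-maximal-side {H = H} _ H-final room (outside ∷ X) ∣X∣ _ =
  ¬CrossIntersecting-outside∷ ∣ H ∣ X (subst (λ k → ∣ H ∣ + k ≤ _) (sym ∣X∣) room) (inj₂ refl)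
    (λ Y ∣Y∣ → cong suc ∣Y∣ , ∷-≺-∷⁺ inside (final⇒≺-greatest H H-final Y ∣Y∣))

final-inside∷-inside∷-maximal : {F H : Subset n} → ∣ F ∣ + suc ∣ H ∣ ≤ n → IsFinal F → IsFinal H →
  MaximalSets (inside ∷ F) (inside ∷ H)
final-inside∷-inside∷-maximal {n} {F} {H} room F-final H-final =
  CrossIntersecting-inside∷ (¬L-inside∷-outside∷ F) (¬L-inside∷-outside∷ H) ,
  final-inside∷-maximal-side F-final H-final room′ ,
  λ Y ∣Y∣ Y∉ ci⁺ → final-inside∷-maximal-side H-final F-final room Y ∣Y∣ Y∉ (CrossIntersecting-sym ci⁺)
  where
  room′ : ∣ H ∣ + suc ∣ F ∣ ≤ n
  room′ = subst (_≤ n) (trans (+-comm ∣ F ∣ (suc ∣ H ∣)) (sym (+-suc ∣ H ∣ ∣ F ∣))) room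

¬outside∷-outside∷-maximal : {F H : Subset n} → ∣ F ∣ + ∣ H ∣ ≤ suc n →
  ¬ MaximalSets (outside ∷ F) (outside ∷ H)
¬outside∷-outside∷-maximal {n} {F} {H} size M@(ci , _ , _)
  with k , ∣F∣ ← Nonempty⇒∣∣≡suc F (Nonempty-∩⇒Nonempty H F
         (Nonempty-∩-comm F H (Nonempty-outside∷-∩⁻ outside F H (maximal⇒Nonempty M)))) =
  ¬CrossIntersecting-outside∷ k H room (refl , ≺-refl (outside ∷ H))
    (λ X ∣X∣ → trans (cong suc ∣X∣) (sym ∣F∣) , inside∷≺outside∷ X F)
    (CrossIntersecting-sym ci)
  where
  room : k + ∣ H ∣ ≤ n
  room = ≤-pred (subst (λ a → a + ∣ H ∣ ≤ suc n) ∣F∣ size)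

Interlocked : Subset n → Subset n → Set
Interlocked [] [] = ⊥
Interlocked (inside ∷ F) (inside ∷ H) = IsFinal F × IsFinal H
Interlocked (inside ∷ F) (outside ∷ H) = Interlocked F H
Interlocked (outside ∷ F) (inside ∷ H) = Interlocked F H
Interlocked (outside ∷ F) (outside ∷ H) = ⊥

maximal⇔interlocked : (F H : Subset n) → ∣ F ∣ + ∣ H ∣ ≤ n → MaximalSets F H ⇔ Interlocked F H
maximal⇔interlocked [] [] _ = mk⇔ (¬Fin0 ∘ proj₁ ∘ maximal⇒Nonempty) λ ()
maximal⇔interlocked (inside ∷ F) (inside ∷ H) size = mk⇔
  (λ M → inside∷-inside∷-maximal⇒final M , inside∷-inside∷-maximal⇒final (maximal-sym M))
  (λ (F-final , H-final) → final-inside∷-inside∷-maximal (≤-pred size) F-final H-final)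
maximal⇔interlocked (inside ∷ F) (outside ∷ H) size = mk⇔
  (Equivalence.to IH ∘ inside∷-outside∷-maximal⁻)
  (inside∷-outside∷-maximal⁺ (≤-pred size) ∘ Equivalence.from IH)
  where
  IH : MaximalSets F H ⇔ Interlocked F H
  IH = maximal⇔interlocked F H (≤-pred size)
maximal⇔interlocked {suc n} (outside ∷ F) (inside ∷ H) size = mk⇔
  (Equivalence.to IH ∘ maximal-sym ∘ inside∷-outside∷-maximal⁻ ∘ maximal-sym)
  (maximal-sym ∘ inside∷-outside∷-maximal⁺ (subst (_≤ n) (+-comm ∣ F ∣ ∣ H ∣) size′) ∘ maximal-sym ∘
   Equivalence.from IH)
  where
  size′ : ∣ F ∣ + ∣ H ∣ ≤ n
  size′ = ≤-pred-+-suc size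
  IH : MaximalSets F H ⇔ Interlocked F H
  IH = maximal⇔interlocked F H size′
maximal⇔interlocked (outside ∷ F) (outside ∷ H) size = mk⇔ (¬outside∷-outside∷-maximal size) λ ()

-- The final run Fᵗ and the core F ∖ Fᵗ

leadingRun-⊤ : ∀ m → leadingRun (⊤ {m}) ≡ m
leadingRun-⊤ zero = refl
leadingRun-⊤ (suc m) = cong suc (leadingRun-⊤ m)

leadingRun-⊤∷ʳoutside : ∀ m → leadingRun (⊤ {m} ∷ʳ outside) ≡ m
leadingRun-⊤∷ʳoutside zero = refl
leadingRun-⊤∷ʳoutside (suc m) = cong suc (leadingRun-⊤∷ʳoutside m)

leadingRun≤ : (u : Subset n) → leadingRun u ≤ n
leadingRun≤ [] = z≤n
leadingRun≤ (inside ∷ u) = s≤s (leadingRun≤ u)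
leadingRun≤ (outside ∷ u) = z≤n

leadingRun-∷ʳ : ∀ x (u : Subset n) → u ≢ ⊤ → leadingRun (u ∷ʳ x) ≡ leadingRun u
leadingRun-∷ʳ x [] []≢⊤ = contradiction refl []≢⊤
leadingRun-∷ʳ x (inside ∷ u) u≢⊤ = cong suc (leadingRun-∷ʳ x u (u≢⊤ ∘ cong (inside ∷_)))
leadingRun-∷ʳ x (outside ∷ u) _ = refl

reverse-⊤ : reverse (⊤ {n}) ≡ ⊤
reverse-⊤ = begin
  reverse ⊤                          ≡⟨ cong reverse (map-const ⊤ inside) ⟨
  reverse (Vec.map (const inside) ⊤) ≡⟨ map-reverse (const inside) ⊤ ⟨
  Vec.map (const inside) (reverse ⊤) ≡⟨ map-const (reverse ⊤) inside ⟩
  ⊤                                  ∎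
  where open ≡-Reasoning

ℓ-⊤ : ℓ (⊤ {n}) ≡ n
ℓ-⊤ {n} = trans (cong leadingRun reverse-⊤) (leadingRun-⊤ n)

ℓ≤ : (F : Subset n) → ℓ F ≤ n
ℓ≤ F = leadingRun≤ (reverse F)

reverse≡⊤⇒≡⊤ : (F : Subset n) → reverse F ≡ ⊤ → F ≡ ⊤
reverse≡⊤⇒≡⊤ F rev≡⊤ = reverse-injective {xs = F} {ys = ⊤} (trans rev≡⊤ (sym reverse-⊤))

ℓ-∷ : ∀ x (F : Subset n) → x ∷ F ≢ ⊤ → ℓ (x ∷ F) ≡ ℓ F
ℓ-∷ x F x∷F≢⊤ with ≡-dec _≟ᵇ_ (reverse F) ⊤
... | no rev≢⊤ = trans (cong leadingRun (reverse-∷ x F)) (leadingRun-∷ʳ x (reverse F) rev≢⊤)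
ℓ-∷ inside F x∷F≢⊤ | yes rev≡⊤ = contradiction (cong (inside ∷_) (reverse≡⊤⇒≡⊤ F rev≡⊤)) x∷F≢⊤
ℓ-∷ outside F _ | yes rev≡⊤ = begin
  leadingRun (reverse (outside ∷ F)) ≡⟨ cong leadingRun (reverse-∷ outside F) ⟩
  leadingRun (reverse F ∷ʳ outside)  ≡⟨ cong (leadingRun ∘ (_∷ʳ outside)) rev≡⊤ ⟩
  leadingRun (⊤ ∷ʳ outside)          ≡⟨ leadingRun-⊤∷ʳoutside _ ⟩
  _                                  ≡⟨ trans (cong ℓ (reverse≡⊤⇒≡⊤ F rev≡⊤)) ℓ-⊤ ⟨
  ℓ F                                ∎
  where open ≡-Reasoning

ℓ< : (F : Subset n) → F ≢ ⊤ → ℓ F < n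
ℓ< [] []≢⊤ = contradiction refl []≢⊤
ℓ< (x ∷ F) x∷F≢⊤ = subst (_< suc _) (sym (ℓ-∷ x F x∷F≢⊤)) (s≤s (ℓ≤ F))

-- The set [n - k + 1, n]; in particular F ᵗ is finalSegment n (ℓ F) by definition.
finalSegment : ∀ n → ℕ → Subset n
finalSegment n k = tabulate (λ i → if does (n ≤? toℕ i + k) then inside else outside)

finalSegment-suc : ∀ m k →
  finalSegment (suc m) k ≡ (if does (suc m ≤? k) then inside else outside) ∷ finalSegment m k
finalSegment-suc m k = cong ((if does (suc m ≤? k) then inside else outside) ∷_) (tabulate-cong λ i →
  cong (if_then inside else outside) (does-⇔ (mk⇔ ≤-pred s≤s) (suc m ≤? suc (toℕ i + k)) (m ≤? toℕ i + k)))

finalSegment-⊤ : ∀ n {k} → n ≤ k → finalSegment n k ≡ ⊤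
finalSegment-⊤ zero _ = refl
finalSegment-⊤ (suc m) {k} 1+m≤k =
  trans (finalSegment-suc m k)
        (cong₂ (λ b S → (if b then inside else outside) ∷ S)
               (dec-true (suc m ≤? k) 1+m≤k) (finalSegment-⊤ m (ℕ.<⇒≤ 1+m≤k)))

ᵗ-∷ : ∀ x (F : Subset n) → x ∷ F ≢ ⊤ → (x ∷ F) ᵗ ≡ outside ∷ F ᵗ
ᵗ-∷ {n} x F x∷F≢⊤ =
  trans (finalSegment-suc n (ℓ (x ∷ F)))
        (cong₂ (λ b S → (if b then inside else outside) ∷ S)
               (dec-false (suc n ≤? ℓ (x ∷ F)) (ℕ.<⇒≱ (ℓ< (x ∷ F) x∷F≢⊤)))
               (cong (finalSegment n) (ℓ-∷ x F x∷F≢⊤)))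

core : Subset n → Subset n
core F = F ─ F ᵗ

core-∷ : ∀ x (F : Subset n) → x ∷ F ≢ ⊤ → core (x ∷ F) ≡ x ∷ core F
core-∷ x F x∷F≢⊤ = cong ((x ∷ F) ─_) (ᵗ-∷ x F x∷F≢⊤)

core-⊤ : core (⊤ {n}) ≡ ∅
core-⊤ {n} = trans (cong (⊤ ─_) (finalSegment-⊤ n (ℕ.≤-reflexive (sym ℓ-⊤)))) (p─⊤≡⊥ ⊤)

final⇒core≡∅ : (F : Subset n) → IsFinal F → core F ≡ ∅
final⇒core≡∅ [] _ = refl
final⇒core≡∅ (inside ∷ F) refl = core-⊤
final⇒core≡∅ (outside ∷ F) F-final =
  trans (core-∷ outside F λ ()) (cong (outside ∷_) (final⇒core≡∅ F F-final))

core≡∅⇒final : (F : Subset n) → core F ≡ ∅ → IsFinal F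
core≡∅⇒final {n} F _ with ≡-dec _≟ᵇ_ F ⊤
... | yes refl = ⊤-final n
core≡∅⇒final [] _ | no _ = Unit.tt
core≡∅⇒final (x ∷ F) core≡∅ | no x∷F≢⊤ with ∷-injective (trans (sym (core-∷ x F x∷F≢⊤)) core≡∅)
... | refl , coreF≡∅ = core≡∅⇒final F coreF≡∅

final⇒ℓ≡∣∣ : (F : Subset n) → IsFinal F → ℓ F ≡ ∣ F ∣
final⇒ℓ≡∣∣ [] _ = refl
final⇒ℓ≡∣∣ (inside ∷ F) refl = trans ℓ-⊤ (sym (∣⊤∣≡n _))
final⇒ℓ≡∣∣ (outside ∷ F) F-final = trans (ℓ-∷ outside F λ ()) (final⇒ℓ≡∣∣ F F-final)

-- Parity with the size bookkeeping removed: F is G with its final run made d longer.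
Lengthens : ℕ → Subset n → Subset n → Set
Lengthens d G F = core G ≡ core F × ℓ F ≡ ℓ G + d

Lengthens⇒≢⊤ : ∀ {d} {G F : Subset n} → Lengthens d G F → F ≢ ⊤ → G ≢ ⊤
Lengthens⇒≢⊤ {n} {d} {F = F} (_ , ℓ≡) F≢⊤ refl =
  ℕ.m+n≮m n d (subst (_< n) (trans ℓ≡ (cong (_+ d) ℓ-⊤)) (ℓ< F F≢⊤))

Lengthens-∷⁻ : ∀ {d} x y {G F : Subset n} → Lengthens d (x ∷ G) (y ∷ F) → y ∷ F ≢ ⊤ →
  x ≡ y × Lengthens d G F
Lengthens-∷⁻ {d = d} x y {G} {F} len@(core≡ , ℓ≡) y∷F≢⊤
  with x∷G≢⊤ ← Lengthens⇒≢⊤ len y∷F≢⊤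
  with refl , core-tail≡ ← ∷-injective (trans (sym (core-∷ x G x∷G≢⊤)) (trans core≡ (core-∷ y F y∷F≢⊤))) =
  refl , core-tail≡ , trans (sym (ℓ-∷ y F y∷F≢⊤)) (trans ℓ≡ (cong (_+ d) (ℓ-∷ x G x∷G≢⊤)))

Lengthens-∷⁺ : ∀ {d} x {G F : Subset n} → Lengthens d G F → x ∷ G ≢ ⊤ → x ∷ F ≢ ⊤ →
  Lengthens d (x ∷ G) (x ∷ F)
Lengthens-∷⁺ {d = d} x {G} {F} (core≡ , ℓ≡) x∷G≢⊤ x∷F≢⊤ =
  trans (core-∷ x G x∷G≢⊤) (trans (cong (x ∷_) core≡) (sym (core-∷ x F x∷F≢⊤))) ,
  trans (ℓ-∷ x F x∷F≢⊤) (trans ℓ≡ (cong (_+ d) (sym (ℓ-∷ x G x∷G≢⊤))))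

final-Lengthens : ∀ {d} {G F : Subset n} → IsFinal G → IsFinal F → ∣ F ∣ ≡ ∣ G ∣ + d → Lengthens d G F
final-Lengthens {d = d} {G} {F} G-final F-final ∣F∣ =
  trans (final⇒core≡∅ G G-final) (sym (final⇒core≡∅ F F-final)) ,
  trans (final⇒ℓ≡∣∣ F F-final) (trans ∣F∣ (cong (_+ d) (sym (final⇒ℓ≡∣∣ G G-final))))

-- Shortening and lengthening the final run

Interlocked⇒Nonempty : (F H : Subset n) → Interlocked F H → Nonempty (F ∩ H)
Interlocked⇒Nonempty [] [] ()
Interlocked⇒Nonempty (inside ∷ F) (inside ∷ H) _ = zero , here
Interlocked⇒Nonempty (inside ∷ F) (outside ∷ H) I =
  Nonempty-∷-∩-∷⁺ inside outside (Interlocked⇒Nonempty F H I)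
Interlocked⇒Nonempty (outside ∷ F) (inside ∷ H) I =
  Nonempty-∷-∩-∷⁺ outside inside (Interlocked⇒Nonempty F H I)

Interlocked⇒≢⊤ : (F H : Subset n) → Interlocked F H → ∣ F ∣ + ∣ H ∣ ≤ n → F ≢ ⊤
Interlocked⇒≢⊤ F H I = Nonempty-∩⇒≢⊤ F H (Interlocked⇒Nonempty F H I)

interlocked-shorten : ∀ {d} (G F H : Subset n) → Lengthens d G F → Interlocked F H → ∣ F ∣ + ∣ H ∣ ≤ n →
  Interlocked G H

interlocked-shorten-tail : ∀ {d} x z (G F H : Subset n) → Lengthens d G F →
  Interlocked (x ∷ F) (z ∷ H) → ∣ x ∷ F ∣ + ∣ z ∷ H ∣ ≤ suc n → Interlocked (x ∷ G) (z ∷ H)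

interlocked-shorten [] [] [] _ ()
interlocked-shorten (x ∷ G) (y ∷ F) (z ∷ H) len I size
  with refl , len′ ← Lengthens-∷⁻ x y len (Interlocked⇒≢⊤ (y ∷ F) (z ∷ H) I size) =
  interlocked-shorten-tail x z G F H len′ I size

interlocked-shorten-tail inside inside G F H (core≡ , _) (F-final , H-final) _ =
  core≡∅⇒final G (trans core≡ (final⇒core≡∅ F F-final)) , H-final
interlocked-shorten-tail inside outside G F H len I size = interlocked-shorten G F H len I (≤-pred size)
interlocked-shorten-tail outside inside G F H len I size = interlocked-shorten G F H len I (≤-pred-+-suc size)

interlocked-lengthen : ∀ d (G H : Subset n) → Interlocked G H → ∣ G ∣ + d + ∣ H ∣ ≤ n →
  Σ (Subset n) λ F → Lengthens d G F × Interlocked F H × ∣ F ∣ ≡ ∣ G ∣ + d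

interlocked-lengthen-tail : ∀ d x z (G H : Subset n) → Interlocked (x ∷ G) (z ∷ H) →
  ∣ x ∷ G ∣ + d + ∣ z ∷ H ∣ ≤ suc n →
  Σ (Subset n) λ F → Lengthens d G F × Interlocked (x ∷ F) (z ∷ H) × ∣ x ∷ F ∣ ≡ ∣ x ∷ G ∣ + d

interlocked-lengthen d [] [] ()
interlocked-lengthen {suc n} d (x ∷ G) (z ∷ H) I size
  with F , len , I′ , ∣x∷F∣ ← interlocked-lengthen-tail d x z G H I size =
  x ∷ F ,
  Lengthens-∷⁺ x len (Interlocked⇒≢⊤ (x ∷ G) (z ∷ H) I size-G) (Interlocked⇒≢⊤ (x ∷ F) (z ∷ H) I′ size-F) ,
  I′ , ∣x∷F∣
  where
  size-G : ∣ x ∷ G ∣ + ∣ z ∷ H ∣ ≤ suc n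
  size-G = ≤-trans (ℕ.+-monoˡ-≤ ∣ z ∷ H ∣ (m≤m+n ∣ x ∷ G ∣ d)) size
  size-F : ∣ x ∷ F ∣ + ∣ z ∷ H ∣ ≤ suc n
  size-F = subst (λ k → k + ∣ z ∷ H ∣ ≤ suc n) (sym ∣x∷F∣) size

interlocked-lengthen-tail d inside inside G H (G-final , H-final) size
  with F , F-final , ∣F∣ ← final-of-size (≤-trans (m≤m+n (∣ G ∣ + d) (suc ∣ H ∣)) (≤-pred size)) =
  F , final-Lengthens G-final F-final ∣F∣ , (F-final , H-final) , cong suc ∣F∣
interlocked-lengthen-tail d inside outside G H I size
  with F , len , I′ , ∣F∣ ← interlocked-lengthen d G H I (≤-pred size) = F , len , I′ , cong suc ∣F∣
interlocked-lengthen-tail d outside inside G H I size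
  with F , len , I′ , ∣F∣ ← interlocked-lengthen d G H I (≤-pred-+-suc size) = F , len , I′ , ∣F∣

-- Counting

module _ {A : Set} (_≟_ : DecidableEquality A) (R : A → A → Set) where

  related-onto : (xs ys : List A) → Unique xs → length ys ≤ length xs →
    (∀ {x} → x ∈ˡ xs → Σ A λ y → y ∈ˡ ys × R x y) →
    (∀ {x x′ y} → x ∈ˡ xs → x′ ∈ˡ xs → R x y → R x′ y → x ≡ x′) →
    ∀ {y} → y ∈ˡ ys → Σ A λ x → x ∈ˡ xs × R x y
  related-onto [] (_ ∷ _) _ () _ _ _
  related-onto (x ∷ xs) ys (x∉xs ∷ xs-unique) ys≤xs image injective {y} y∈ys
    with y₀ , y₀∈ys , Rxy₀ ← image (here refl)
    with y ≟ y₀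
  ... | yes refl = x , here refl , Rxy₀
  ... | no y≢y₀ =
    map₂ (map₁ there) (related-onto xs ys′ xs-unique ys′≤xs image′ injective′ (∈-filter⁺ ≢y₀? y∈ys y≢y₀))
    where
    ≢y₀? : (y : A) → Dec (y ≢ y₀)
    ≢y₀? y = ¬? (y ≟ y₀)
    ys′ : List A
    ys′ = filter ≢y₀? ys
    ys′≤xs : length ys′ ≤ length xs
    ys′≤xs = ≤-pred (≤-trans (filter-notAll ≢y₀? ys (Any.map (λ y₀≡ y₀≢ → y₀≢ (sym y₀≡)) y₀∈ys)) ys≤xs)
    image′ : ∀ {x′} → x′ ∈ˡ xs → Σ A λ y′ → y′ ∈ˡ ys′ × R x′ y′
    image′ x′∈xs with y′ , y′∈ys , Rx′y′ ← image (there x′∈xs) =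
      y′ , ∈-filter⁺ ≢y₀? y′∈ys y′≢y₀ , Rx′y′
      where
      y′≢y₀ : y′ ≢ y₀
      y′≢y₀ refl = All.lookup x∉xs x′∈xs (injective (here refl) (there x′∈xs) Rxy₀ Rx′y′)
    injective′ : ∀ {x₁ x₂ y} → x₁ ∈ˡ xs → x₂ ∈ˡ xs → R x₁ y → R x₂ y → x₁ ≡ x₂
    injective′ x₁∈ x₂∈ = injective (there x₁∈) (there x₂∈)

allSubsets-complete : (A : Subset n) → A ∈ˡ allSubsets n
allSubsets-complete [] = here refl
allSubsets-complete (outside ∷ A) = ∈-++⁺ˡ (∈-map⁺ (outside ∷_) (allSubsets-complete A))
allSubsets-complete {suc n} (inside ∷ A) =
  ∈-++⁺ʳ (List.map (outside ∷_) (allSubsets n)) (∈-map⁺ (inside ∷_) (allSubsets-complete A))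

allSubsets-unique : ∀ n → Unique (allSubsets n)
allSubsets-unique zero = All.[] ∷ []
allSubsets-unique (suc n) =
  Unique.++⁺ (Unique.map⁺ ∷-injectiveʳ (allSubsets-unique n)) (Unique.map⁺ ∷-injectiveʳ (allSubsets-unique n))
    disjoint
  where
  disjoint : ∀ {A} → ¬ (A ∈ˡ List.map (outside ∷_) (allSubsets n) × A ∈ˡ List.map (inside ∷_) (allSubsets n))
  disjoint (A∈ , A∈′) with ∈-map⁻ (outside ∷_) A∈ | ∈-map⁻ (inside ∷_) A∈′
  ... | _ , _ , refl | _ , _ , ()

members : Family n → List (Subset n)
members {n} 𝒞 = filterᵇ 𝒞 (allSubsets n)

∈-members⁺ : (𝒞 : Family n) {A : Subset n} → T (𝒞 A) → A ∈ˡ members 𝒞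
∈-members⁺ 𝒞 {A} A∈𝒞 = ∈-filter⁺ (T? ∘ 𝒞) (allSubsets-complete A) A∈𝒞

∈-members⁻ : (𝒞 : Family n) {A : Subset n} → A ∈ˡ members 𝒞 → T (𝒞 A)
∈-members⁻ {n} 𝒞 A∈ = proj₂ (∈-filter⁻ (T? ∘ 𝒞) {xs = allSubsets n} A∈)

#≡⇒related-onto : (𝒜 ℬ : Family n) (R : Subset n → Subset n → Set) → # 𝒜 ≡ # ℬ →
  (∀ A → T (𝒜 A) → Σ (Subset n) λ B → T (ℬ B) × R A B) →
  (∀ {A A′ B} → T (𝒜 A) → T (𝒜 A′) → R A B → R A′ B → A ≡ A′) →
  ∀ B → T (ℬ B) → Σ (Subset n) λ A → T (𝒜 A) × R A B
#≡⇒related-onto {n} 𝒜 ℬ R #𝒜≡#ℬ image injective B B∈ℬ =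
  map₂ (map₁ (∈-members⁻ 𝒜))
    (related-onto (≡-dec _≟ᵇ_) R (members 𝒜) (members ℬ)
      (Unique.filter⁺ (T? ∘ 𝒜) (allSubsets-unique n)) (ℕ.≤-reflexive (sym #𝒜≡#ℬ))
      (λ {A} A∈ → map₂ (map₁ (∈-members⁺ ℬ)) (image A (∈-members⁻ 𝒜 A∈)))
      (λ A∈ A′∈ → injective (∈-members⁻ 𝒜 A∈) (∈-members⁻ 𝒜 A′∈))
      (∈-members⁺ ℬ B∈ℬ))

-- Parity

b+g≡a+f⇔b≡a+[f∸g] : ∀ {g f} a b → g ≤ f → (b + g ≡ a + f) ⇔ (b ≡ a + (f ∸ g))
b+g≡a+f⇔b≡a+[f∸g] {g} {f} a b g≤f = mk⇔
  (λ eq → ℕ.+-cancelʳ-≡ g b (a + (f ∸ g)) (trans eq (sym a+[f∸g]+g≡a+f)))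
  (λ eq → trans (cong (_+ g) eq) a+[f∸g]+g≡a+f)
  where
  a+[f∸g]+g≡a+f : a + (f ∸ g) + g ≡ a + f
  a+[f∸g]+g≡a+f = trans (ℕ.+-assoc a (f ∸ g) g) (cong (a +_) (ℕ.m∸n+n≡m g≤f))

Parity⇒Lengthens : ∀ {g f} {G F : Subset n} → Parity g f G F → Lengthens (f ∸ g) G F
Parity⇒Lengthens {G = G} {F} (g≤f , _ , _ , core≡ , ℓ≡) =
  core≡ , Equivalence.to (b+g≡a+f⇔b≡a+[f∸g] (ℓ G) (ℓ F) g≤f) ℓ≡

Lengthens⇒Parity : ∀ {g f} {G F : Subset n} → g ≤ f → ∣ G ∣ ≡ g → ∣ F ∣ ≡ f → Lengthens (f ∸ g) G F →
  Parity g f G F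
Lengthens⇒Parity {G = G} {F} g≤f ∣G∣ ∣F∣ (core≡ , ℓ≡) =
  g≤f , ∣G∣ , ∣F∣ , core≡ , Equivalence.from (b+g≡a+f⇔b≡a+[f∸g] (ℓ G) (ℓ F) g≤f) ℓ≡

maximal-of-parity : ∀ {g f h} {G F H : Subset n} → Parity g f G F → ∣ H ∣ ≡ h → f + h ≤ n →
  MaximalSets F H → MaximalSets G H
maximal-of-parity {n} {G = G} {F} {H} par@(g≤f , ∣G∣ , ∣F∣ , _) ∣H∣ f+h≤n M =
  Equivalence.from (maximal⇔interlocked G H size-G)
    (interlocked-shorten G F H (Parity⇒Lengthens par)
      (Equivalence.to (maximal⇔interlocked F H size-F) M) size-F)
  where
  size-F : ∣ F ∣ + ∣ H ∣ ≤ n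
  size-F = subst₂ (λ a b → a + b ≤ n) (sym ∣F∣) (sym ∣H∣) f+h≤n
  size-G : ∣ G ∣ + ∣ H ∣ ≤ n
  size-G = ≤-trans (ℕ.+-monoˡ-≤ ∣ H ∣ (subst₂ _≤_ (sym ∣G∣) (sym ∣F∣) g≤f)) size-F

maximal-lengthen : ∀ d {G H : Subset n} → MaximalSets G H → ∣ G ∣ + d + ∣ H ∣ ≤ n →
  Σ (Subset n) λ F → Lengthens d G F × MaximalSets F H × ∣ F ∣ ≡ ∣ G ∣ + d
maximal-lengthen {n} d {G} {H} M size =
  let F , len , I , ∣F∣ = interlocked-lengthen d G H (Equivalence.to (maximal⇔interlocked G H size-G) M) size
  in F , len , Equivalence.from (maximal⇔interlocked F H (subst (λ a → a + ∣ H ∣ ≤ n) (sym ∣F∣) size)) I , ∣F∣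
  where
  size-G : ∣ G ∣ + ∣ H ∣ ≤ n
  size-G = ≤-trans (ℕ.+-monoˡ-≤ ∣ H ∣ (m≤m+n ∣ G ∣ d)) size

module PartnerFamilies {f g h n : ℕ} (g≤f : g ≤ f) (f+h≤n : f + h ≤ n) (𝓕 𝓖 : Family n)
  (𝓕-spec : ∀ F → T (𝓕 F) ⇔ (∣ F ∣ ≡ f × ∃[ H ] (∣ H ∣ ≡ h × MaximalSets F H)))
  (𝓖-spec : ∀ G → T (𝓖 G) ⇔ (∣ G ∣ ≡ g × ∃[ H ] (∣ H ∣ ≡ h × MaximalSets G H)))
  where

  g-parity-in-𝓖 : ∀ F → T (𝓕 F) → ∀ G → Parity g f G F → T (𝓖 G)
  g-parity-in-𝓖 F F∈𝓕 G par@(_ , ∣G∣ , _) =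
    let _ , H , ∣H∣ , M = Equivalence.to (𝓕-spec F) F∈𝓕
    in Equivalence.from (𝓖-spec G) (∣G∣ , H , ∣H∣ , maximal-of-parity par ∣H∣ f+h≤n M)

  f-parity-in-𝓕 : ∀ G → T (𝓖 G) → ∃[ F ] (Parity g f G F × T (𝓕 F))
  f-parity-in-𝓕 G G∈𝓖 =
    let ∣G∣ , H , ∣H∣ , M = Equivalence.to (𝓖-spec G) G∈𝓖
        F , len , M′ , ∣F∣ =
          maximal-lengthen (f ∸ g) M (subst₂ (λ a b → a + b ≤ n) (sym (+[f∸g] ∣G∣)) (sym ∣H∣) f+h≤n)
    in F , Lengthens⇒Parity g≤f ∣G∣ (trans ∣F∣ (+[f∸g] ∣G∣)) len ,
       Equivalence.from (𝓕-spec F) (trans ∣F∣ (+[f∸g] ∣G∣) , H , ∣H∣ , M′)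
    where
    +[f∸g] : ∀ {a} → a ≡ g → a + (f ∸ g) ≡ f
    +[f∸g] refl = ℕ.m+[n∸m]≡n g≤f

  𝓗𝓖⊆𝓗𝓕 : (𝓗𝓕 𝓗𝓖 : Family n) → (∀ H → T (𝓗𝓕 H) → ∣ H ∣ ≡ h) → (∀ H → T (𝓗𝓖 H) → ∣ H ∣ ≡ h) →
    MaxPairFamilies 𝓕 𝓗𝓕 → MaxPairFamilies 𝓖 𝓗𝓖 → ∀ H → T (𝓗𝓖 H) → T (𝓗𝓕 H)
  𝓗𝓖⊆𝓗𝓕 𝓗𝓕 𝓗𝓖 𝓗𝓕-size 𝓗𝓖-size (_ , 𝓕-partner) (#𝓖≡#𝓗𝓖 , 𝓖-partner) H H∈𝓗𝓖 =
    let G , G∈𝓖 , M = #≡⇒related-onto 𝓖 𝓗𝓖 MaximalSets #𝓖≡#𝓗𝓖 partner same-partner⇒≡ H H∈𝓗𝓖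
        F , par , F∈𝓕 = f-parity-in-𝓕 G G∈𝓖
        H′ , (H′∈𝓗𝓕 , M′) , _ = 𝓕-partner F F∈𝓕
        ∣H′∣ = 𝓗𝓕-size H′ H′∈𝓗𝓕
    in subst (T ∘ 𝓗𝓕)
         (maximal-partner-unique (maximal-of-parity par ∣H′∣ f+h≤n M′) M (trans ∣H′∣ (sym (𝓗𝓖-size H H∈𝓗𝓖))))
         H′∈𝓗𝓕
    where
    partner : ∀ G → T (𝓖 G) → Σ (Subset n) λ H → T (𝓗𝓖 H) × MaximalSets G H
    partner G G∈𝓖 = let H , H-partner , _ = 𝓖-partner G G∈𝓖 in H , H-partner
    size-of-𝓖 : ∀ {G} → T (𝓖 G) → ∣ G ∣ ≡ g
    size-of-𝓖 {G} = proj₁ ∘ Equivalence.to (𝓖-spec G)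
    same-partner⇒≡ : ∀ {G G′ H} → T (𝓖 G) → T (𝓖 G′) → MaximalSets G H → MaximalSets G′ H → G ≡ G′
    same-partner⇒≡ G∈𝓖 G′∈𝓖 M M′ =
      maximal-partner-unique (maximal-sym M) (maximal-sym M′) (trans (size-of-𝓖 G∈𝓖) (sym (size-of-𝓖 G′∈𝓖)))

proposition2p16 :
    (f g h n : ℕ) → 1 ≤ f → 1 ≤ g → 1 ≤ h → g ≤ f → f + h ≤ n →
    (𝓕 𝓖 𝓗𝓕 𝓗𝓖 : Family n) →
    (∀ F → T (𝓕 F) ⇔ (∣ F ∣ ≡ f × ∃[ H ] (∣ H ∣ ≡ h × MaximalSets F H))) →
    (∀ G → T (𝓖 G) ⇔ (∣ G ∣ ≡ g × ∃[ H ] (∣ H ∣ ≡ h × MaximalSets G H))) →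
    (∀ H → T (𝓗𝓕 H) → ∣ H ∣ ≡ h) →
    (∀ H → T (𝓗𝓖 H) → ∣ H ∣ ≡ h) →
    MaxPairFamilies 𝓕 𝓗𝓕 →
    MaxPairFamilies 𝓖 𝓗𝓖 →
    -- (i) 𝓕 is the f-parity of 𝓖
    ((∀ G → T (𝓖 G) → ∃[ F ] (Parity g f G F × T (𝓕 F)))
      × (∀ F → T (𝓕 F) → ∀ G → Parity g f G F → T (𝓖 G)))
    -- (ii)
    × (∀ H → T (𝓗𝓖 H) → T (𝓗𝓕 H))
    -- (iii)
    × (∀ G → T (𝓖 G) → ∀ F → T (𝓕 F) → Parity g f G F →
         ∀ H → ∣ H ∣ ≡ h → MaximalSets F H → MaximalSets G H)
proposition2p16 f g h n _ _ _ g≤f f+h≤n 𝓕 𝓖 𝓗𝓕 𝓗𝓖 𝓕-spec 𝓖-spec 𝓗𝓕-size 𝓗𝓖-size 𝓕-pairs 𝓖-pairs =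
  (f-parity-in-𝓕 , g-parity-in-𝓖) ,
  𝓗𝓖⊆𝓗𝓕 𝓗𝓕 𝓗𝓖 𝓗𝓕-size 𝓗𝓖-size 𝓕-pairs 𝓖-pairs ,
  λ G _ F _ par H ∣H∣ → maximal-of-parity par ∣H∣ f+h≤n
  where open PartnerFamilies g≤f f+h≤n 𝓕 𝓖 𝓕-spec 𝓖-spec
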